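{- Let $G$ be a cubic Lehman graph with $k=1$, and let $\mathcal{R}$ be its perfect matching of rungs. Then the biclique expansion $e(G,\mathcal{R})$ is a cubic negative Lehman graph.
   Context: A bipartite graph $G$ with $n$ black and $n$ white vertices has bipartite adjacency matrix $A$ (rows indexed by black vertices, columns by white vertices, entry $1$ iff adjacent). $G$ is a cubic Lehman graph with parameter $k\in\{ -1,1,2,\ldots\}$ if $G$ is $3$-regular and there is an $n\times n$ $(0,1)$-matrix $B$ with $AB^T=J+kI$, $J$ the all-ones matrix and $I$ the identity; it is negative if $k=-1$. When $G$ is cubic with $k=1$, the edges $bw$ of $G$ with $B(b,w)=0$ form a perfect matching, the rungs of $G$. Biclique expansion: label the black vertices $b_1,\dots,b_n$ and white vertices $w_1,\dots,w_n$ so that the matching is $\{b_iw_i\}$. The graph $e(G,\mathcal{R})$ has, for each $i$, a set $B_i$ of $2$ black vertices and a set $W_i$ of $2$ white vertices, with every vertex of $B_i$ joined to every vertex of $W_i$; and for each edge $b_iw_j$ of $G$ with $i\neq j$, exactly one edge between $B_i$ and $W_j$, chosen so that each vertex of each $B_i$ and of each $W_j$ is incident with exactly one such edge. (Such choices exist and all yield isomorphic graphs.) -}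

module Defs where

open import Data.Nat using (ℕ; zero; suc; _+_; _*_)
open import Data.Bool using (Bool; true; false; _∨_; _∧_; if_then_else_)
open import Data.Fin using (Fin; zero; suc; remQuot)
open import Data.Fin.Properties using () renaming (_≟_ to _≟ᶠ_)
open import Data.Integer using (ℤ; +_; -[1+_]) renaming (_+_ to _+ℤ_)
open import Data.Product using (Σ; ∃; _×_; _,_; proj₁; proj₂)
open import Relation.Nullary using (¬_; does)
open import Relation.Binary.PropositionalEquality using (_≡_)

∑ : ∀ {n} → (Fin n → ℕ) → ℕ
∑ {zero}  f = 0
∑ {suc n} f = f zero + ∑ (λ i → f (suc i))

b2n : Bool → ℕ
b2n true  = 1
b2n false = 0

-- Bipartite adjacency matrix: rows = black vertices, columns = white vertices
BiMat : ℕ → Set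
BiMat n = Fin n → Fin n → Bool

Cubic : ∀ {n} → BiMat n → Set
Cubic {n} A = (∀ i → ∑ (λ j → b2n (A i j)) ≡ 3) × (∀ j → ∑ (λ i → b2n (A i j)) ≡ 3)

LehmanWitness : ∀ {n} → BiMat n → ℤ → BiMat n → Set
LehmanWitness {n} A k B =
  ∀ i j → + (∑ (λ l → b2n (A i l) * b2n (B j l)))
          ≡ + 1 +ℤ (if does (i ≟ᶠ j) then k else + 0)

CubicLehman : ∀ {n} → BiMat n → ℤ → Set
CubicLehman {n} A k = Cubic A × Σ (BiMat n) (LehmanWitness A k)

CubicNegativeLehman : ∀ {n} → BiMat n → Set
CubicNegativeLehman A = CubicLehman A -[1+ 0 ]

-- m is the rung matching: black b_i is matched to white w_(m i), and the rungs
-- (edges bw with A(b,w)=1, B(b,w)=0) are exactly the pairs (i, m i).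
IsRungMatching : ∀ {n} → BiMat n → BiMat n → (Fin n → Fin n) → Set
IsRungMatching A B m =
  ∀ b w → ((A b w ≡ true × B b w ≡ false) → w ≡ m b) × (w ≡ m b → (A b w ≡ true × B b w ≡ false))

-- A valid choice for the biclique expansion: f (i , a) is the white vertex (j , c)
-- (vertex c of W_j) joined to vertex a of B_i by a non-biclique edge.
ValidChoice : ∀ {n} → BiMat n → (Fin n → Fin n) → (Fin n × Fin 2 → Fin n × Fin 2) → Set
ValidChoice {n} A m f =
  -- each white vertex of each W_j is incident with exactly one such edge
  (∀ x y → f x ≡ f y → x ≡ y) × (∀ y → ∃ λ x → f x ≡ y) ×
  (∀ i a → A i (proj₁ (f (i , a))) ≡ true × ¬ (proj₁ (f (i , a)) ≡ m i)) ×
  (∀ i j → A i j ≡ true → ¬ (j ≡ m i) →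
     (∃ λ a → proj₁ (f (i , a)) ≡ j) ×
     (∀ a a' → proj₁ (f (i , a)) ≡ j → proj₁ (f (i , a')) ≡ j → a ≡ a'))

_==_ : ∀ {n} → Fin n → Fin n → Bool
i == j = does (i ≟ᶠ j)

-- Biclique expansion e(G, R): black vertex (i , a) ∈ Fin n × Fin 2 ≅ Fin (n * 2)
-- is vertex a of B_i; white vertex (j , c) is vertex c of W_j.
expansion : ∀ {n} → (Fin n → Fin n) → (Fin n × Fin 2 → Fin n × Fin 2) → BiMat (n * 2)
expansion {n} m f x y with remQuot {n} 2 x | remQuot {n} 2 y
... | (i , a) | (j , c) = (j == m i) ∨ ((proj₁ (f (i , a)) == j) ∧ (proj₂ (f (i , a)) == c))

-- Write f for the choice of non-rung edges and owner w for the index i with w = f (i , a). A black vertex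
-- (i , a) of the expansion E sees both vertices of W_(m i) and the vertex f (i , a), so the rows of E sum to 3.
-- At a white vertex w_j of G, two of the three edges are reached from the two vertices of W_j through f, so
-- exactly one rung ends at w_j: m is a bijection and the columns of E sum to 3 as well.
-- The witness is B′ (y , w) = B (owner w) j′ ∧ w ≠ f y, where j′ is the first coordinate of f y: adding
-- [x = y] + [j′ = m i] to (E B′ᵀ) (x , y) for x = (i , a) gives the sum of B l j′ over the three neighbours l
-- of w_(m i), that is (Bᵀ A) (j′ , m i) = 1 + [j′ = m i].
-- Finally Bᵀ A = J + I: the identity A Bᵀ = J + I yields an integer matrix R with A R = (n + 1) I, so A is
-- injective, and A (Bᵀ A) = (J + I) A = A (J + I) because A is 3-regular.
module Submission where

open import Defs
open import Algebra.Bundles using (CommutativeMonoid)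
open import Data.Bool using (Bool; true; false; _∧_; _∨_; not; if_then_else_)
open import Data.Nat using (ℕ; zero; suc)
open import Data.Fin using (Fin; zero; suc; punchIn; punchOut; _↑ˡ_; _↑ʳ_; combine; remQuot)
open import Data.Fin.Properties using (punchInᵢ≢i; any?; remQuot-combine; combine-remQuot) renaming (_≟_ to _≟ᶠ_)
open import Data.Product using (∃; _×_; _,_; proj₁; proj₂; uncurry)
open import Data.Product.Properties using (×-≡,≡→≡; ×-≡,≡←≡)
open import Data.Sum using (inj₁; inj₂)
open import Data.Vec.Functional using (_∷_; insertAt; map; removeAt)
open import Data.Vec.Functional.Properties using (insertAt-lookup; insertAt-punchIn; removeAt-punchOut)
open import Function using (_∘_; const)
open import Function.Bundles using (mk⇔; _⇔_)
open import Relation.Binary using (DecidableEquality)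
open import Relation.Nullary using (¬_; Dec; yes; no; does; ¬?; contradiction)
open import Relation.Nullary.Decidable using (map′; _×-dec_; does-⇔; dec-true; dec-false)
open import Relation.Binary.PropositionalEquality
  using (_≡_; _≢_; refl; sym; trans; cong; cong₂; subst; subst₂; module ≡-Reasoning)

module MonoidSums {c ℓ} (M : CommutativeMonoid c ℓ) where
  open CommutativeMonoid M
  open import Algebra.Properties.CommutativeMonoid.Sum M using (sum; sum-remove; sum-cong-≋; sum-replicate-zero)
  open import Relation.Binary.Reasoning.Setoid setoid

  sum-zero : ∀ {n} {t : Fin n → Carrier} → (∀ l → t l ≈ ε) → sum t ≈ ε
  sum-zero {n} {t} t≈ε = begin
    sum t             ≈⟨ sum-cong-≋ t≈ε ⟩
    sum {n} (const ε) ≈⟨ sum-replicate-zero n ⟩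
    ε                 ∎

  sum-supportedAt : ∀ {n} (t : Fin (suc n) → Carrier) k → (∀ l → l ≢ k → t l ≈ ε) → sum t ≈ t k
  sum-supportedAt t k t-vanishes = begin
    sum t                     ≈⟨ sum-remove {i = k} t ⟩
    t k ∙ sum (removeAt t k)  ≈⟨ ∙-congˡ (sum-zero (λ q → t-vanishes (punchIn k q) (punchInᵢ≢i k q))) ⟩
    t k ∙ ε                   ≈⟨ identityʳ (t k) ⟩
    t k                       ∎

module IntegerMatrix where
  open import Data.Nat as ℕ using (s≤s)
  open import Data.Nat.Properties using (n<1+n; m<n⇒m<1+n)
  open import Data.Integer using (ℤ; +_; _+_; _*_; -_; _-_)
  open import Data.Integer.Properties
    using (+-*-semiring; +-0-commutativeMonoid; *-identityˡ; *-identityʳ; *-comm; *-assoc; *-zeroʳ;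
           +-identityˡ; +-identityʳ; i*j≡0⇒i≡0∨j≡0; i-j≡0⇒i≡j)
    renaming (_≟_ to _≟ℤ_)
  open import Data.Integer.Solver using (module +-*-Solver)
  open import Algebra.Properties.Semiring.Sum +-*-semiring
    using (sum; ∑-distrib-+; ∑-comm; *-distribˡ-sum; *-distribʳ-sum; sum-remove; sum-cong-≗)
  open MonoidSums +-0-commutativeMonoid using (sum-supportedAt; sum-zero)
  open +-*-Solver
  open ≡-Reasoning

  Matrix : ℕ → ℕ → Set
  Matrix m n = Fin m → Fin n → ℤ

  infix  8 _ᵀ
  infixl 7 _*ᵥ_ _*ₘ_

  _ᵀ : ∀ {m n} → Matrix m n → Matrix n m
  (M ᵀ) i j = M j i

  _*ᵥ_ : ∀ {m n} → Matrix m n → (Fin n → ℤ) → Fin m → ℤ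
  (M *ᵥ v) i = sum (λ j → M i j * v j)

  _*ₘ_ : ∀ {m n p} → Matrix m n → Matrix n p → Matrix m p
  (M *ₘ N) i k = sum (λ j → M i j * N j k)

  δ : ∀ {n} → Matrix n n
  δ i j = if does (i ≟ᶠ j) then + 1 else + 0

  J+kI : ∀ {n} → ℤ → Matrix n n
  J+kI k i j = + 1 + k * δ i j

  δ-sym : ∀ {n} (i j : Fin n) → δ i j ≡ δ j i
  δ-sym i j = cong (λ b → if b then + 1 else + 0) (does-⇔ (mk⇔ sym sym) (i ≟ᶠ j) (j ≟ᶠ i))

  sum-δ : ∀ {n} (k : Fin n) (g : Fin n → ℤ) → sum (λ l → δ k l * g l) ≡ g k
  sum-δ {suc n} k g = trans (sum-supportedAt (λ l → δ k l * g l) k vanishes) k-term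
    where
    k-term : δ k k * g k ≡ g k
    k-term rewrite dec-true (k ≟ᶠ k) refl = *-identityˡ (g k)
    vanishes : ∀ l → l ≢ k → δ k l * g l ≡ + 0
    vanishes l l≢k rewrite dec-false (k ≟ᶠ l) (l≢k ∘ sym) = refl

  sum-const-1 : ∀ n → sum {n} (const (+ 1)) ≡ + n
  sum-const-1 zero    = refl
  sum-const-1 (suc n) = cong (λ s → + 1 + s) (sum-const-1 n)

  sum-linear : ∀ {n} (a b : ℤ) (f g : Fin n → ℤ) → sum (λ q → a * f q + b * g q) ≡ a * sum f + b * sum g
  sum-linear a b f g = trans (∑-distrib-+ (λ q → a * f q) (λ q → b * g q))
                             (sym (cong₂ _+_ (*-distribˡ-sum a f) (*-distribˡ-sum b g)))

  *ᵥ-cong : ∀ {m n} (M : Matrix m n) {v w : Fin n → ℤ} → (∀ l → v l ≡ w l) → ∀ i → (M *ᵥ v) i ≡ (M *ᵥ w) i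
  *ᵥ-cong M v≡w i = sum-cong-≗ (λ l → cong (M i l *_) (v≡w l))

  *ᵥ-linear : ∀ {m n} (M : Matrix m n) (a b : ℤ) (v w : Fin n → ℤ) i →
              (M *ᵥ (λ l → a * v l + b * w l)) i ≡ a * (M *ᵥ v) i + b * (M *ᵥ w) i
  *ᵥ-linear M a b v w i = trans (sum-cong-≗ (λ l → distribute (M i l) (v l) (w l)))
                                (sum-linear a b (λ l → M i l * v l) (λ l → M i l * w l))
    where
    distribute : ∀ x y z → x * (a * y + b * z) ≡ a * (x * y) + b * (x * z)
    distribute x y z = solve 5 (λ x y z a b → x :* (a :* y :+ b :* z) := a :* (x :* y) :+ b :* (x :* z)) refl x y z a b

  sum-factor : ∀ {n} (a : ℤ) (f g : Fin n → ℤ) → sum (λ l → f l * (a * g l)) ≡ a * sum (λ l → f l * g l)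
  sum-factor a f g = trans (sum-cong-≗ (λ l → solve 3 (λ x a y → x :* (a :* y) := a :* (x :* y)) refl (f l) a (g l)))
                           (sym (*-distribˡ-sum a (λ l → f l * g l)))

  *ₘ-*ᵥ-assoc : ∀ {m n p} (M : Matrix m n) (N : Matrix n p) v i → ((M *ₘ N) *ᵥ v) i ≡ (M *ᵥ (N *ᵥ v)) i
  *ₘ-*ᵥ-assoc M N v i = begin
    sum (λ k → sum (λ j → M i j * N j k) * v k)
      ≡⟨ sum-cong-≗ (λ k → *-distribʳ-sum (v k) (λ j → M i j * N j k)) ⟩
    sum (λ k → sum (λ j → M i j * N j k * v k))
      ≡⟨ ∑-comm (λ k j → M i j * N j k * v k) ⟩
    sum (λ j → sum (λ k → M i j * N j k * v k))
      ≡⟨ sum-cong-≗ (λ j → trans (sum-cong-≗ (λ k → *-assoc (M i j) (N j k) (v k)))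
                                 (sym (*-distribˡ-sum (M i j) (λ k → N j k * v k)))) ⟩
    sum (λ j → M i j * sum (λ k → N j k * v k)) ∎

  J+kI-*ᵥ : ∀ {n} k (g : Fin n → ℤ) i → (J+kI k *ᵥ g) i ≡ sum g + k * g i
  J+kI-*ᵥ k g i = begin
    sum (λ j → (+ 1 + k * δ i j) * g j)
      ≡⟨ sum-cong-≗ (λ j → solve 3 (λ k d x → (con (+ 1) :+ k :* d) :* x := con (+ 1) :* x :+ k :* (d :* x)) refl
                                   k (δ i j) (g j)) ⟩
    sum (λ j → + 1 * g j + k * (δ i j * g j))   ≡⟨ sum-linear (+ 1) k g (λ j → δ i j * g j) ⟩
    + 1 * sum g + k * sum (λ j → δ i j * g j)   ≡⟨ cong₂ (λ s t → s + k * t) (*-identityˡ (sum g)) (sum-δ i g) ⟩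
    sum g + k * g i                             ∎

  -- Back-substitution: c solves the system reduced by the pivot u p, and its extension also solves the row u.
  pivotExtend : ∀ {k} (u : Fin (suc k) → ℤ) (p : Fin (suc k)) (c : Fin k → ℤ) → Fin (suc k) → ℤ
  pivotExtend u p c = insertAt (map (u p *_) c) p (- sum (λ q → u (punchIn p q) * c q))

  pivotExtend-eliminates : ∀ {k} u p (c : Fin k → ℤ) (v : Fin (suc k) → ℤ) →
    sum (λ q → v q * pivotExtend u p c q) ≡ sum (λ q → (u p * v (punchIn p q) - v p * u (punchIn p q)) * c q)
  pivotExtend-eliminates {k} u p c v = begin
    sum (λ q → v q * e q)
      ≡⟨ sum-remove (λ q → v q * e q) ⟩
    v p * e p + sum (λ q → v (punchIn p q) * e (punchIn p q))
      ≡⟨ cong₂ _+_ (cong (v p *_) (insertAt-lookup _ p _))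
                   (sum-cong-≗ (λ q → cong (v (punchIn p q) *_) (insertAt-punchIn _ p _ q))) ⟩
    v p * (- U) + sum (λ q → v (punchIn p q) * (u p * c q))
      ≡⟨ cong (λ t → v p * (- U) + t) (sum-factor (u p) (v ∘ punchIn p) c) ⟩
    v p * (- U) + u p * sum V
      ≡⟨ solve 4 (λ x s a t → x :* (:- s) :+ a :* t := a :* t :+ (:- x) :* s) refl (v p) U (u p) (sum V) ⟩
    u p * sum V + (- v p) * U
      ≡⟨ sum-linear (u p) (- v p) V (λ q → u (punchIn p q) * c q) ⟨
    sum (λ q → u p * V q + (- v p) * (u (punchIn p q) * c q))
      ≡⟨ sum-cong-≗ (λ q → solve 5 (λ a x m y c → a :* (x :* c) :+ (:- m) :* (y :* c) := (a :* x :- m :* y) :* c) refl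
                                   (u p) (v (punchIn p q)) (v p) (u (punchIn p q)) (c q)) ⟩
    sum (λ q → (u p * v (punchIn p q) - v p * u (punchIn p q)) * c q) ∎
    where
    e : Fin (suc k) → ℤ
    e = pivotExtend u p c
    U : ℤ
    U = sum (λ q → u (punchIn p q) * c q)
    V : Fin k → ℤ
    V q = v (punchIn p q) * c q

  NonZeroVector : ∀ {k} → (Fin k → ℤ) → Set
  NonZeroVector c = ∃ λ q → c q ≢ + 0

  wide⇒nontrivialKernel : ∀ {m k} → m ℕ.< k → (M : Matrix m k) →
                          ∃ λ c → NonZeroVector c × (∀ r → (M *ᵥ c) r ≡ + 0)
  wide⇒nontrivialKernel {zero}  {suc k} _ M = const (+ 1) , (zero , λ ()) , λ ()
  wide⇒nontrivialKernel {suc m} {suc k} (s≤s m<k) M with any? (λ p → ¬? (M zero p ≟ℤ + 0))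
  ... | no no-pivot with wide⇒nontrivialKernel (m<n⇒m<1+n m<k) (M ∘ suc)
  ...   | c , c≢0 , M₊c≡0 = c , c≢0 , rows
    where
    row₀≡0 : ∀ q → M zero q ≡ + 0
    row₀≡0 q with M zero q ≟ℤ + 0
    ... | yes eq  = eq
    ... | no  neq = contradiction (q , neq) no-pivot
    rows : ∀ r → (M *ᵥ c) r ≡ + 0
    rows zero    = sum-zero (λ q → cong (_* c q) (row₀≡0 q))
    rows (suc r) = M₊c≡0 r
  wide⇒nontrivialKernel {suc m} {suc k} (s≤s m<k) M | yes (p , pivot≢0) with wide⇒nontrivialKernel m<k M′
    where
    M′ : Matrix m k
    M′ r q = M zero p * M (suc r) (punchIn p q) - M (suc r) p * M zero (punchIn p q)
  ... | c , (q₀ , cq₀≢0) , M′c≡0 = pivotExtend (M zero) p c , (punchIn p q₀ , extension≢0) , rows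
    where
    extension≢0 : pivotExtend (M zero) p c (punchIn p q₀) ≢ + 0
    extension≢0 eq with i*j≡0⇒i≡0∨j≡0 (M zero p) (trans (sym (insertAt-punchIn _ p _ q₀)) eq)
    ... | inj₁ pivot≡0 = pivot≢0 pivot≡0
    ... | inj₂ cq₀≡0   = cq₀≢0 cq₀≡0
    rows : ∀ r → (M *ᵥ pivotExtend (M zero) p c) r ≡ + 0
    rows zero    = trans (pivotExtend-eliminates (M zero) p c (M zero))
                         (sum-zero (λ q → solve 3 (λ a x y → (a :* x :- a :* x) :* y := con (+ 0)) refl
                                                  (M zero p) (M zero (punchIn p q)) (c q)))
    rows (suc r) = trans (pivotExtend-eliminates (M zero) p c (M (suc r))) (M′c≡0 r)

  scaledIdentity⇒trivialKernel : ∀ {n} (M : Matrix n n) (d : ℤ) → d ≢ + 0 → (∀ i k → M i k ≡ d * δ i k) →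
                                 ∀ c → (∀ i → (M *ᵥ c) i ≡ + 0) → ∀ k → c k ≡ + 0
  scaledIdentity⇒trivialKernel M d d≢0 M≡dI c Mc≡0 k with i*j≡0⇒i≡0∨j≡0 d dck≡0
    where
    dck≡0 : d * c k ≡ + 0
    dck≡0 = begin
      d * c k                          ≡⟨ sum-δ k (λ j → d * c j) ⟨
      sum (λ j → δ k j * (d * c j))    ≡⟨ sum-cong-≗ (λ j → solve 3 (λ e d c → e :* (d :* c) := d :* e :* c) refl
                                                                (δ k j) d (c j)) ⟩
      sum (λ j → d * δ k j * c j)      ≡⟨ sum-cong-≗ (λ j → cong (_* c j) (M≡dI k j)) ⟨
      (M *ᵥ c) k                       ≡⟨ Mc≡0 k ⟩
      + 0                              ∎
  ... | inj₁ d≡0  = contradiction d≡0 d≢0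
  ... | inj₂ ck≡0 = ck≡0

  -- x, R₀, …, Rₙ₋₁ are n + 1 vectors in ℤⁿ, so x c₀ + R c′ = 0 for a nonzero c; applying A gives d c′ = 0,
  -- hence c′ = 0, c₀ ≢ 0 and x = 0.
  rightInverse⇒trivialKernel : ∀ {n} (A R : Matrix n n) (d : ℤ) → d ≢ + 0 → (∀ i k → (A *ₘ R) i k ≡ d * δ i k) →
                               ∀ x → (∀ i → (A *ᵥ x) i ≡ + 0) → ∀ l → x l ≡ + 0
  rightInverse⇒trivialKernel {n} A R d d≢0 AR≡dI x Ax≡0 with wide⇒nontrivialKernel (n<1+n n) (λ r → x r ∷ R r)
  ... | c , c≢0 , dependence = x≡0
    where
    c₀ : ℤ
    c₀ = c zero
    c′ : Fin n → ℤ
    c′ k = c (suc k)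
    Rc′≡-c₀x : ∀ r → (R *ᵥ c′) r ≡ - c₀ * x r
    Rc′≡-c₀x r = begin
      (R *ᵥ c′) r                             ≡⟨ solve 3 (λ t y c → t := (y :* c :+ t) :+ (:- c) :* y) refl
                                                         ((R *ᵥ c′) r) (x r) c₀ ⟩
      (x r * c₀ + (R *ᵥ c′) r) + - c₀ * x r   ≡⟨ cong (λ t → t + - c₀ * x r) (dependence r) ⟩
      + 0 + - c₀ * x r                        ≡⟨ +-identityˡ (- c₀ * x r) ⟩
      - c₀ * x r                              ∎
    ARc′≡0 : ∀ k → (A *ᵥ (R *ᵥ c′)) k ≡ + 0
    ARc′≡0 k = begin
      (A *ᵥ (R *ᵥ c′)) k                ≡⟨ *ᵥ-cong A Rc′≡-c₀x k ⟩
      (A *ᵥ (λ r → - c₀ * x r)) k       ≡⟨ sum-factor (- c₀) (A k) x ⟩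
      - c₀ * (A *ᵥ x) k                 ≡⟨ cong (- c₀ *_) (Ax≡0 k) ⟩
      - c₀ * + 0                        ≡⟨ *-zeroʳ (- c₀) ⟩
      + 0                               ∎
    c′≡0 : ∀ k → c′ k ≡ + 0
    c′≡0 = scaledIdentity⇒trivialKernel (A *ₘ R) d d≢0 AR≡dI c′ (λ k → trans (*ₘ-*ᵥ-assoc A R c′ k) (ARc′≡0 k))
    c₀≢0 : c₀ ≢ + 0
    c₀≢0 = headOf c≢0
      where
      headOf : NonZeroVector c → c₀ ≢ + 0
      headOf (zero  , c₀≢0) = c₀≢0
      headOf (suc k , cₖ≢0) = contradiction (c′≡0 k) cₖ≢0
    xc₀≡0 : ∀ l → x l * c₀ ≡ + 0
    xc₀≡0 l = begin
      x l * c₀                  ≡⟨ +-identityʳ (x l * c₀) ⟨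
      x l * c₀ + + 0            ≡⟨ cong (λ t → x l * c₀ + t) Rc′≡0 ⟨
      x l * c₀ + (R *ᵥ c′) l    ≡⟨ dependence l ⟩
      + 0                       ∎
      where
      Rc′≡0 : (R *ᵥ c′) l ≡ + 0
      Rc′≡0 = sum-zero (λ k → trans (cong (R l k *_) (c′≡0 k)) (*-zeroʳ (R l k)))
    x≡0 : ∀ l → x l ≡ + 0
    x≡0 l with i*j≡0⇒i≡0∨j≡0 (x l) (xc₀≡0 l)
    ... | inj₁ xl≡0 = xl≡0
    ... | inj₂ c₀≡0 = contradiction c₀≡0 c₀≢0

  rightInverse⇒*ᵥ-injective : ∀ {n} (A R : Matrix n n) (d : ℤ) → d ≢ + 0 → (∀ i k → (A *ₘ R) i k ≡ d * δ i k) →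
                              ∀ x y → (∀ i → (A *ᵥ x) i ≡ (A *ᵥ y) i) → ∀ l → x l ≡ y l
  rightInverse⇒*ᵥ-injective A R d d≢0 AR≡dI x y Ax≡Ay l =
    i-j≡0⇒i≡j (x l) (y l) (rightInverse⇒trivialKernel A R d d≢0 AR≡dI (λ l → x l - y l) A[x-y]≡0 l)
    where
    A[x-y]≡0 : ∀ i → (A *ᵥ (λ l → x l - y l)) i ≡ + 0
    A[x-y]≡0 i = begin
      (A *ᵥ (λ l → x l - y l)) i
        ≡⟨ *ᵥ-cong A (λ l → solve 2 (λ x y → x :- y := con (+ 1) :* x :+ con (- + 1) :* y) refl (x l) (y l)) i ⟩
      (A *ᵥ (λ l → + 1 * x l + (- + 1) * y l)) i
        ≡⟨ *ᵥ-linear A (+ 1) (- + 1) x y i ⟩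
      + 1 * (A *ᵥ x) i + (- + 1) * (A *ᵥ y) i
        ≡⟨ cong (λ t → + 1 * t + (- + 1) * (A *ᵥ y) i) (Ax≡Ay i) ⟩
      + 1 * (A *ᵥ y) i + (- + 1) * (A *ᵥ y) i
        ≡⟨ solve 1 (λ t → con (+ 1) :* t :+ con (- + 1) :* t := con (+ 0)) refl ((A *ᵥ y) i) ⟩
      + 0 ∎

  lehman-transpose : ∀ {n} (A B : Matrix n n) (k r : ℤ) → k ≢ + 0 → + n + k ≢ + 0 →
                     (∀ i → sum (A i) ≡ r) → (∀ j → sum ((A ᵀ) j) ≡ r) →
                     (∀ i j → (A *ₘ B ᵀ) i j ≡ J+kI k i j) → ∀ i j → (B ᵀ *ₘ A) i j ≡ J+kI k i j
  lehman-transpose {n} A B k r k≢0 N≢0 rowSum colSum ABᵀ≡J+kI l j =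
    rightInverse⇒*ᵥ-injective A R (N * k) Nk≢0 AR≡NkI (λ l → (B ᵀ *ₘ A) l j) (λ l → J+kI k l j) Ax≡Ay l
    where
    N : ℤ
    N = + n + k
    s : Fin n → ℤ
    s l = sum (λ t → B t l)
    R : Matrix n n
    R l t = N * B t l - s l
    As≡N : ∀ i → (A *ᵥ s) i ≡ N
    As≡N i = begin
      sum (λ l → A i l * sum (λ t → B t l))  ≡⟨ sum-cong-≗ (λ l → *-distribˡ-sum (A i l) (λ t → B t l)) ⟩
      sum (λ l → sum (λ t → A i l * B t l))  ≡⟨ ∑-comm (λ l t → A i l * B t l) ⟩
      sum (λ t → (A *ₘ B ᵀ) i t)
        ≡⟨ sum-cong-≗ (λ t → trans (ABᵀ≡J+kI i t) (sym (*-identityʳ (J+kI k i t)))) ⟩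
      (J+kI k *ᵥ const (+ 1)) i              ≡⟨ J+kI-*ᵥ k (const (+ 1)) i ⟩
      sum {n} (const (+ 1)) + k * + 1        ≡⟨ cong₂ _+_ (sum-const-1 n) (*-identityʳ k) ⟩
      N                                      ∎
    AR≡NkI : ∀ i t → (A *ₘ R) i t ≡ N * k * δ i t
    AR≡NkI i t = begin
      sum (λ l → A i l * (N * B t l - s l))
        ≡⟨ sum-cong-≗ (λ l → solve 4 (λ a N b s → a :* (N :* b :- s) := N :* (a :* b) :+ con (- + 1) :* (a :* s)) refl
                                     (A i l) N (B t l) (s l)) ⟩
      sum (λ l → N * (A i l * B t l) + (- + 1) * (A i l * s l))
        ≡⟨ sum-linear N (- + 1) (λ l → A i l * B t l) (λ l → A i l * s l) ⟩
      N * (A *ₘ B ᵀ) i t + (- + 1) * (A *ᵥ s) i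
        ≡⟨ cong₂ (λ x y → N * x + (- + 1) * y) (ABᵀ≡J+kI i t) (As≡N i) ⟩
      N * (+ 1 + k * δ i t) + (- + 1) * N
        ≡⟨ solve 3 (λ N k d → N :* (con (+ 1) :+ k :* d) :+ con (- + 1) :* N := N :* k :* d) refl N k (δ i t) ⟩
      N * k * δ i t ∎
    Nk≢0 : N * k ≢ + 0
    Nk≢0 Nk≡0 with i*j≡0⇒i≡0∨j≡0 N Nk≡0
    ... | inj₁ N≡0 = N≢0 N≡0
    ... | inj₂ k≡0 = k≢0 k≡0
    Ax≡Ay : ∀ i → (A *ᵥ (λ l → (B ᵀ *ₘ A) l j)) i ≡ (A *ᵥ (λ l → J+kI k l j)) i
    Ax≡Ay i = begin
      (A *ᵥ (B ᵀ *ᵥ (λ t → A t j))) i     ≡⟨ *ₘ-*ᵥ-assoc A (B ᵀ) (λ t → A t j) i ⟨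
      ((A *ₘ B ᵀ) *ᵥ (λ t → A t j)) i     ≡⟨ sum-cong-≗ (λ t → cong (_* A t j) (ABᵀ≡J+kI i t)) ⟩
      (J+kI k *ᵥ (λ t → A t j)) i         ≡⟨ J+kI-*ᵥ k (λ t → A t j) i ⟩
      sum (λ t → A t j) + k * A i j      ≡⟨ cong (λ x → x + k * A i j) (trans (colSum j) (sym (rowSum i))) ⟩
      sum (A i) + k * A i j              ≡⟨ J+kI-*ᵥ k (A i) j ⟨
      (J+kI k *ᵥ A i) j                  ≡⟨ sum-cong-≗ (λ t → trans (*-comm (J+kI k j t) (A i t))
                                                                    (cong (λ d → A i t * (+ 1 + k * d)) (δ-sym j t))) ⟩
      (A *ᵥ (λ l → J+kI k l j)) i        ∎

module IndicatorSums where
  open import Data.Nat using (_+_; _*_; _≤_)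
  open import Data.Nat.Properties
    using (+-*-semiring; +-0-commutativeMonoid; *-identityʳ; +-identityʳ; *-assoc; +-assoc; m≤m+n; +-monoʳ-≤)
  open import Algebra.Properties.Semiring.Sum +-*-semiring
    using (sum; ∑-distrib-+; ∑-comm; *-distribˡ-sum; sum-remove; sum-cong-≗)
  open MonoidSums +-0-commutativeMonoid using (sum-supportedAt)
  open ≡-Reasoning

  ∑≡sum : ∀ {n} (g : Fin n → ℕ) → ∑ g ≡ sum g
  ∑≡sum {zero}  g = refl
  ∑≡sum {suc n} g = cong (g zero +_) (∑≡sum (g ∘ suc))

  ==-sym : ∀ {n} (i j : Fin n) → (i == j) ≡ (j == i)
  ==-sym i j = does-⇔ (mk⇔ sym sym) (i ≟ᶠ j) (j ≟ᶠ i)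

  sum-δ : ∀ {n} (k : Fin n) (g : Fin n → ℕ) → sum (λ l → b2n (k == l) * g l) ≡ g k
  sum-δ {suc n} k g = trans (sum-supportedAt (λ l → b2n (k == l) * g l) k vanishes) k-term
    where
    k-term : b2n (k == k) * g k ≡ g k
    k-term rewrite dec-true (k ≟ᶠ k) refl = +-identityʳ (g k)
    vanishes : ∀ l → l ≢ k → b2n (k == l) * g l ≡ 0
    vanishes l l≢k rewrite dec-false (k ≟ᶠ l) (l≢k ∘ sym) = refl

  term≤sum : ∀ {n} (t : Fin n → ℕ) i → t i ≤ sum t
  term≤sum {suc n} t i = subst (t i ≤_) (sym (sum-remove {i = i} t)) (m≤m+n (t i) (sum (removeAt t i)))

  term+term≤sum : ∀ {n} (t : Fin n → ℕ) {i l} → l ≢ i → t i + t l ≤ sum t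
  term+term≤sum {suc n} t {i} {l} l≢i = subst (t i + t l ≤_) (sym (sum-remove {i = i} t)) (+-monoʳ-≤ (t i) tl≤rest)
    where
    tl≤rest : t l ≤ sum (removeAt t i)
    tl≤rest = subst (_≤ sum (removeAt t i)) (removeAt-punchOut t (l≢i ∘ sym))
                    (term≤sum (removeAt t i) (punchOut (l≢i ∘ sym)))

  b2n-∧ : ∀ b c → b2n (b ∧ c) ≡ b2n b * b2n c
  b2n-∧ true  c = sym (+-identityʳ (b2n c))
  b2n-∧ false c = refl

  b2n-∨-disjoint : ∀ {P Q : Set} (p? : Dec P) (q? : Dec Q) → ¬ (P × Q) →
                   b2n (does p? ∨ does q?) ≡ b2n (does p?) + b2n (does q?)
  b2n-∨-disjoint (yes p) (yes q) ¬p×q = contradiction (p , q) ¬p×q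
  b2n-∨-disjoint (yes _) (no _)  _    = refl
  b2n-∨-disjoint (no _)  _       _    = refl

  b2n-∧-not : ∀ b {Q : Set} (q? : Dec Q) → (Q → b ≡ true) → b2n (b ∧ not (does q?)) + b2n (does q?) ≡ b2n b
  b2n-∧-not b     (yes q) q⇒b rewrite q⇒b q = refl
  b2n-∧-not true  (no _)  _   = refl
  b2n-∧-not false (no _)  _   = refl

  sum× : ∀ {n k} → (Fin n × Fin k → ℕ) → ℕ
  sum× h = sum (λ i → sum (λ a → h (i , a)))

  sum×-cong : ∀ {n k} {g h : Fin n × Fin k → ℕ} → (∀ p → g p ≡ h p) → sum× g ≡ sum× h
  sum×-cong g≡h = sum-cong-≗ (λ i → sum-cong-≗ (λ a → g≡h (i , a)))

  sum×-distrib-+ : ∀ {n k} (g h : Fin n × Fin k → ℕ) → sum× (λ p → g p + h p) ≡ sum× g + sum× h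
  sum×-distrib-+ g h = trans (sum-cong-≗ (λ i → ∑-distrib-+ (λ a → g (i , a)) (λ a → h (i , a))))
                             (∑-distrib-+ (λ i → sum (λ a → g (i , a))) (λ i → sum (λ a → h (i , a))))

  sum×-comm : ∀ {n k m} (F : Fin n × Fin k → Fin m → ℕ) → sum× (λ p → sum (F p)) ≡ sum (λ c → sum× (λ p → F p c))
  sum×-comm F = trans (sum-cong-≗ (λ i → ∑-comm (λ a → F (i , a)))) (∑-comm (λ i c → sum (λ a → F (i , a) c)))

  _≟ᴾ_ : ∀ {n k} → DecidableEquality (Fin n × Fin k)
  p ≟ᴾ q = map′ ×-≡,≡→≡ ×-≡,≡←≡ ((proj₁ p ≟ᶠ proj₁ q) ×-dec (proj₂ p ≟ᶠ proj₂ q))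

  _==ᴾ_ : ∀ {n k} → Fin n × Fin k → Fin n × Fin k → Bool
  p ==ᴾ q = does (p ≟ᴾ q)

  sum×-δ : ∀ {n k} (p : Fin n × Fin k) (h : Fin n × Fin k → ℕ) → sum× (λ q → b2n (p ==ᴾ q) * h q) ≡ h p
  sum×-δ (i , a) h = begin
    sum (λ j → sum (λ c → b2n ((i == j) ∧ (a == c)) * h (j , c)))
      ≡⟨ sum-cong-≗ (λ j → trans (sum-cong-≗ (λ c → factor j c)) (sym (*-distribˡ-sum (b2n (i == j)) (inner j)))) ⟩
    sum (λ j → b2n (i == j) * sum (inner j))   ≡⟨ sum-δ i (λ j → sum (inner j)) ⟩
    sum (inner i)                              ≡⟨ sum-δ a (λ c → h (i , c)) ⟩
    h (i , a)                                  ∎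
    where
    inner : Fin _ → Fin _ → ℕ
    inner j c = b2n (a == c) * h (j , c)
    factor : ∀ j c → b2n ((i == j) ∧ (a == c)) * h (j , c) ≡ b2n (i == j) * inner j c
    factor j c = trans (cong (_* h (j , c)) (b2n-∧ (i == j) (a == c))) (*-assoc (b2n (i == j)) (b2n (a == c)) (h (j , c)))

  sum×-δ₁ : ∀ {n k} (j : Fin n) (h : Fin n × Fin k → ℕ) → sum× (λ q → b2n (proj₁ q == j) * h q) ≡ sum (λ c → h (j , c))
  sum×-δ₁ j h = begin
    sum (λ i → sum (λ c → b2n (i == j) * h (i , c)))
      ≡⟨ sum-cong-≗ (λ i → sym (*-distribˡ-sum (b2n (i == j)) (λ c → h (i , c)))) ⟩
    sum (λ i → b2n (i == j) * sum (λ c → h (i , c)))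
      ≡⟨ sum-cong-≗ (λ i → cong (λ b → b2n b * sum (λ c → h (i , c))) (==-sym i j)) ⟩
    sum (λ i → b2n (j == i) * sum (λ c → h (i , c)))
      ≡⟨ sum-δ j (λ i → sum (λ c → h (i , c))) ⟩
    sum (λ c → h (j , c)) ∎

  sum-==ᴾ : ∀ {n k} (p : Fin n × Fin k) (j : Fin n) → sum (λ c → b2n (p ==ᴾ (j , c))) ≡ b2n (proj₁ p == j)
  sum-==ᴾ (i , a) j = begin
    sum (λ c → b2n ((i == j) ∧ (a == c)))
      ≡⟨ sum-cong-≗ (λ c → trans (b2n-∧ (i == j) (a == c))
                                 (cong (b2n (i == j) *_) (sym (*-identityʳ (b2n (a == c)))))) ⟩
    sum (λ c → b2n (i == j) * (b2n (a == c) * 1))  ≡⟨ *-distribˡ-sum (b2n (i == j)) (λ c → b2n (a == c) * 1) ⟨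
    b2n (i == j) * sum (λ c → b2n (a == c) * 1)    ≡⟨ cong (b2n (i == j) *_) (sum-δ a (const 1)) ⟩
    b2n (i == j) * 1                               ≡⟨ *-identityʳ (b2n (i == j)) ⟩
    b2n (i == j)                                   ∎

  sum-↑ : ∀ a b (g : Fin (a + b) → ℕ) → sum g ≡ sum (λ i → g (i ↑ˡ b)) + sum (λ i → g (a ↑ʳ i))
  sum-↑ zero    b g = refl
  sum-↑ (suc a) b g = trans (cong (g zero +_) (sum-↑ a b (g ∘ suc)))
                            (sym (+-assoc (g zero) (sum (λ i → g (suc (i ↑ˡ b)))) (sum (λ i → g (suc (a ↑ʳ i))))))

  sum-combine : ∀ n k (g : Fin (n * k) → ℕ) → sum g ≡ sum× {n} {k} (λ p → g (combine (proj₁ p) (proj₂ p)))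
  sum-combine zero    k g = refl
  sum-combine (suc n) k g = trans (sum-↑ k (n * k) g)
                                  (cong (sum (λ a → g (a ↑ˡ (n * k))) +_) (sum-combine n k (λ y → g (k ↑ʳ y))))

  sum-remQuot : ∀ n k (g : Fin n × Fin k → ℕ) → sum (λ y → g (remQuot k y)) ≡ sum× g
  sum-remQuot n k g = trans (sum-combine n k (λ y → g (remQuot k y)))
                            (sum×-cong (λ (i , a) → cong g (remQuot-combine i a)))

  ==-remQuot : ∀ n k (x y : Fin (n * k)) → (x == y) ≡ (remQuot {n} k x ==ᴾ remQuot k y)
  ==-remQuot n k x y = does-⇔ (mk⇔ (cong (remQuot {n} k)) remQuot-injective) (x ≟ᶠ y) (remQuot {n} k x ≟ᴾ remQuot k y)
    where
    remQuot-injective : remQuot {n} k x ≡ remQuot k y → x ≡ y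
    remQuot-injective eq =
      trans (sym (combine-remQuot {n} k x)) (trans (cong (uncurry combine) eq) (combine-remQuot {n} k y))

module BicliqueExpansion {n : ℕ} (A B : BiMat n) (m : Fin n → Fin n) (f : Fin n × Fin 2 → Fin n × Fin 2)
                         (rungs : IsRungMatching A B m) (valid : ValidChoice A m f) where
  open import Data.Nat using (_+_; _*_; _≤_; s≤s)
  open import Data.Nat.Properties
    using (+-*-semiring; +-0-commutativeMonoid; *-identityʳ; +-identityʳ; *-comm; *-distribʳ-+; +-cancelʳ-≡; +-comm)
  open import Data.Nat.Solver using (module +-*-Solver)
  open import Algebra.Properties.Semiring.Sum +-*-semiring using (sum; ∑-distrib-+; *-distribʳ-sum; sum-cong-≗)
  open IndicatorSums
  open MonoidSums +-0-commutativeMonoid using (sum-supportedAt; sum-zero)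
  open ≡-Reasoning

  Vertex : Set
  Vertex = Fin n × Fin 2

  target : Vertex → Fin n
  target x = proj₁ (f x)

  f-injective : ∀ {x y} → f x ≡ f y → x ≡ y
  f-injective {x} {y} = proj₁ valid x y

  f⁻¹ : Vertex → Vertex
  f⁻¹ w = proj₁ (proj₁ (proj₂ valid) w)

  f∘f⁻¹ : ∀ w → f (f⁻¹ w) ≡ w
  f∘f⁻¹ w = proj₂ (proj₁ (proj₂ valid) w)

  f⁻¹∘f : ∀ x → f⁻¹ (f x) ≡ x
  f⁻¹∘f x = f-injective (f∘f⁻¹ (f x))

  owner : Vertex → Fin n
  owner w = proj₁ (f⁻¹ w)

  f-edge : ∀ x → A (proj₁ x) (target x) ≡ true
  f-edge (i , a) = proj₁ (proj₁ (proj₂ (proj₂ valid)) i a)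

  f-nonRung : ∀ x → target x ≢ m (proj₁ x)
  f-nonRung (i , a) = proj₂ (proj₁ (proj₂ (proj₂ valid)) i a)

  f-covers : ∀ {i j} → A i j ≡ true → j ≢ m i → ∃ λ a → target (i , a) ≡ j
  f-covers {i} {j} Aij j≢mi = proj₁ (proj₂ (proj₂ (proj₂ valid)) i j Aij j≢mi)

  f-coversOnce : ∀ {i j a a′} → A i j ≡ true → j ≢ m i → target (i , a) ≡ j → target (i , a′) ≡ j → a ≡ a′
  f-coversOnce {i} {j} {a} {a′} Aij j≢mi = proj₂ (proj₂ (proj₂ (proj₂ valid)) i j Aij j≢mi) a a′

  rung-edge : ∀ i → A i (m i) ≡ true
  rung-edge i = proj₁ (proj₂ (rungs i (m i)) refl)

  f-edge-B : ∀ x → B (proj₁ x) (target x) ≡ true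
  f-edge-B (i , a) with B i (target (i , a)) in Bia
  ... | true  = refl
  ... | false = contradiction (proj₁ (rungs i (target (i , a))) (f-edge (i , a) , Bia)) (f-nonRung (i , a))

  f-==ᴾ : ∀ x w → (f x ==ᴾ w) ≡ (f⁻¹ w ==ᴾ x)
  f-==ᴾ x w = does-⇔ (mk⇔ (λ fx≡w → trans (cong f⁻¹ (sym fx≡w)) (f⁻¹∘f x))
                          (λ f⁻¹w≡x → trans (cong f (sym f⁻¹w≡x)) (f∘f⁻¹ w)))
                     (f x ≟ᴾ w) (f⁻¹ w ≟ᴾ x)

  sum×-f : ∀ w (h : Vertex → ℕ) → sum× (λ x → b2n (f x ==ᴾ w) * h x) ≡ h (f⁻¹ w)
  sum×-f w h = trans (sum×-cong (λ x → cong (λ b → b2n b * h x) (f-==ᴾ x w))) (sum×-δ (f⁻¹ w) h)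

  targetCount-rung : ∀ i → sum (λ a → b2n (target (i , a) == m i)) ≡ 0
  targetCount-rung i = sum-zero (λ a → cong b2n (dec-false (target (i , a) ≟ᶠ m i) (f-nonRung (i , a))))

  targetCount-edge : ∀ {i j} → A i j ≡ true → j ≢ m i → sum (λ a → b2n (target (i , a) == j)) ≡ 1
  targetCount-edge {i} {j} Aij j≢mi with f-covers Aij j≢mi
  ... | a , ta≡j = trans (sum-supportedAt (λ a′ → b2n (target (i , a′) == j)) a only-a)
                         (cong b2n (dec-true (target (i , a) ≟ᶠ j) ta≡j))
    where
    only-a : ∀ a′ → a′ ≢ a → b2n (target (i , a′) == j) ≡ 0
    only-a a′ a′≢a = cong b2n (dec-false (target (i , a′) ≟ᶠ j) (λ ta′≡j → a′≢a (f-coversOnce Aij j≢mi ta′≡j ta≡j)))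

  targetCount-nonEdge : ∀ {i j} → A i j ≡ false → sum (λ a → b2n (target (i , a) == j)) ≡ 0
  targetCount-nonEdge {i} {j} Aij = sum-zero (λ a → cong b2n (dec-false (target (i , a) ≟ᶠ j) (no-edge a)))
    where
    no-edge : ∀ a → target (i , a) ≢ j
    no-edge a ta≡j = contradiction (trans (sym (subst (λ j → A i j ≡ true) ta≡j (f-edge (i , a)))) Aij) λ ()

  A-rowDecomposition : ∀ i j → b2n (A i j) ≡ b2n (j == m i) + sum (λ a → b2n (target (i , a) == j))
  A-rowDecomposition i j with j ≟ᶠ m i
  ... | yes refl = trans (cong b2n (rung-edge i)) (cong suc (sym (targetCount-rung i)))
  ... | no j≢mi with A i j in Aij
  ...   | true  = sym (targetCount-edge Aij j≢mi)
  ...   | false = sym (targetCount-nonEdge Aij)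

  A-colDecomposition : ∀ M (g : Fin n → ℕ) →
    sum (λ l → b2n (A l M) * g l) ≡ sum (λ l → b2n (M == m l) * g l) + sum (λ c → g (owner (M , c)))
  A-colDecomposition M g = begin
    sum (λ l → b2n (A l M) * g l)
      ≡⟨ sum-cong-≗ (λ l → trans (cong (_* g l) (A-rowDecomposition l M)) (*-distribʳ-+ (g l) (b2n (M == m l)) (T l))) ⟩
    sum (λ l → b2n (M == m l) * g l + T l * g l)
      ≡⟨ ∑-distrib-+ (λ l → b2n (M == m l) * g l) (λ l → T l * g l) ⟩
    sum (λ l → b2n (M == m l) * g l) + sum (λ l → T l * g l)
      ≡⟨ cong (sum (λ l → b2n (M == m l) * g l) +_) owners ⟩
    sum (λ l → b2n (M == m l) * g l) + sum (λ c → g (owner (M , c))) ∎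
    where
    T : Fin n → ℕ
    T l = sum (λ a → b2n (target (l , a) == M))
    owners : sum (λ l → T l * g l) ≡ sum (λ c → g (owner (M , c)))
    owners = begin
      sum (λ l → T l * g l)
        ≡⟨ sum-cong-≗ (λ l → *-distribʳ-sum (g l) (λ a → b2n (target (l , a) == M))) ⟩
      sum× (λ x → b2n (target x == M) * g (proj₁ x))
        ≡⟨ sum×-cong (λ x → cong (_* g (proj₁ x)) (sym (sum-==ᴾ (f x) M))) ⟩
      sum× (λ x → sum (λ c → b2n (f x ==ᴾ (M , c))) * g (proj₁ x))
        ≡⟨ sum×-cong (λ x → *-distribʳ-sum (g (proj₁ x)) (λ c → b2n (f x ==ᴾ (M , c)))) ⟩
      sum× (λ x → sum (λ c → b2n (f x ==ᴾ (M , c)) * g (proj₁ x)))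
        ≡⟨ sum×-comm (λ x c → b2n (f x ==ᴾ (M , c)) * g (proj₁ x)) ⟩
      sum (λ c → sum× (λ x → b2n (f x ==ᴾ (M , c)) * g (proj₁ x)))
        ≡⟨ sum-cong-≗ (λ c → sum×-f (M , c) (g ∘ proj₁)) ⟩
      sum (λ c → g (owner (M , c))) ∎

  E : Vertex → Vertex → Bool
  E x w = (proj₁ w == m (proj₁ x)) ∨ (f x ==ᴾ w)

  flatten : (Vertex → Vertex → Bool) → BiMat (n * 2)
  flatten M x y = M (remQuot 2 x) (remQuot 2 y)

  expansion≡E : ∀ x y → expansion m f x y ≡ flatten E x y
  expansion≡E x y with remQuot {n} 2 x | remQuot {n} 2 y
  ... | i , a | j , c = refl

  b2n-E : ∀ x w → b2n (E x w) ≡ b2n (proj₁ w == m (proj₁ x)) + b2n (f x ==ᴾ w)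
  b2n-E x w = b2n-∨-disjoint (proj₁ w ≟ᶠ m (proj₁ x)) (f x ≟ᴾ w)
                             (λ (w≡mx , fx≡w) → f-nonRung x (trans (cong proj₁ fx≡w) w≡mx))

  E-rowSum : ∀ x (h : Vertex → ℕ) → sum× (λ w → b2n (E x w) * h w) ≡ sum (λ c → h (m (proj₁ x) , c)) + h (f x)
  E-rowSum x h = begin
    sum× (λ w → b2n (E x w) * h w)
      ≡⟨ sum×-cong (λ w → trans (cong (_* h w) (b2n-E x w)) (*-distribʳ-+ (h w) (rung w) (b2n (f x ==ᴾ w)))) ⟩
    sum× (λ w → rung w * h w + b2n (f x ==ᴾ w) * h w)
      ≡⟨ sum×-distrib-+ (λ w → rung w * h w) (λ w → b2n (f x ==ᴾ w) * h w) ⟩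
    sum× (λ w → rung w * h w) + sum× (λ w → b2n (f x ==ᴾ w) * h w)
      ≡⟨ cong₂ _+_ (sum×-δ₁ (m (proj₁ x)) h) (sum×-δ (f x) h) ⟩
    sum (λ c → h (m (proj₁ x) , c)) + h (f x) ∎
    where
    rung : Vertex → ℕ
    rung w = b2n (proj₁ w == m (proj₁ x))

  expansion-rowSum : ∀ x → ∑ (λ y → b2n (expansion m f x y)) ≡ 3
  expansion-rowSum x = begin
    ∑ (λ y → b2n (expansion m f x y))        ≡⟨ ∑≡sum (λ y → b2n (expansion m f x y)) ⟩
    sum (λ y → b2n (expansion m f x y))      ≡⟨ sum-cong-≗ (λ y → cong b2n (expansion≡E x y)) ⟩
    sum (λ y → b2n (E p (remQuot 2 y)))      ≡⟨ sum-remQuot n 2 (λ w → b2n (E p w)) ⟩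
    sum× (λ w → b2n (E p w))                 ≡⟨ sum×-cong (λ w → sym (*-identityʳ (b2n (E p w)))) ⟩
    sum× (λ w → b2n (E p w) * 1)             ≡⟨ E-rowSum p (const 1) ⟩
    3                                        ∎
    where
    p : Vertex
    p = remQuot 2 x

  Bᴱ : Vertex → Vertex → Bool
  Bᴱ y w = B (owner w) (target y) ∧ not (f y ==ᴾ w)

  Bᴱ-split : ∀ y w → b2n (Bᴱ y w) + b2n (f y ==ᴾ w) ≡ b2n (B (owner w) (target y))
  Bᴱ-split y w = b2n-∧-not (B (owner w) (target y)) (f y ≟ᴾ w) partner
    where
    partner : f y ≡ w → B (owner w) (target y) ≡ true
    partner fy≡w = subst (λ v → B (proj₁ v) (target y) ≡ true) (trans (sym (f⁻¹∘f y)) (cong f⁻¹ fy≡w))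
                         (f-edge-B y)

  module _ (colSum : ∀ j → ∑ (λ i → b2n (A i j)) ≡ 3) where

    rungCount : ∀ M → sum (λ l → b2n (M == m l)) ≡ 1
    rungCount M = +-cancelʳ-≡ 2 (sum (λ l → b2n (M == m l))) 1 (begin
      sum (λ l → b2n (M == m l)) + 2
        ≡⟨ cong (_+ 2) (sum-cong-≗ (λ l → sym (*-identityʳ (b2n (M == m l))))) ⟩
      sum (λ l → b2n (M == m l) * 1) + sum {2} (const 1)
        ≡⟨ A-colDecomposition M (const 1) ⟨
      sum (λ l → b2n (A l M) * 1)
        ≡⟨ sum-cong-≗ (λ l → *-identityʳ (b2n (A l M))) ⟩
      sum (λ l → b2n (A l M))
        ≡⟨ ∑≡sum (λ l → b2n (A l M)) ⟨
      ∑ (λ l → b2n (A l M))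
        ≡⟨ colSum M ⟩
      3 ∎)

    m-injective : ∀ {l i} → m l ≡ m i → l ≡ i
    m-injective {l} {i} ml≡mi with l ≟ᶠ i
    ... | yes l≡i = l≡i
    ... | no  l≢i = contradiction two≤one λ { (s≤s ()) }
      where
      rung : ∀ l′ → m l′ ≡ m i → b2n (m i == m l′) ≡ 1
      rung l′ ml′≡mi = cong b2n (dec-true (m i ≟ᶠ m l′) (sym ml′≡mi))
      two≤one : 2 ≤ 1
      two≤one = subst₂ _≤_ (cong₂ _+_ (rung i refl) (rung l ml≡mi)) (rungCount (m i))
                       (term+term≤sum (λ l′ → b2n (m i == m l′)) l≢i)

    sum-rung : ∀ i (g : Fin n → ℕ) → sum (λ l → b2n (m i == m l) * g l) ≡ g i
    sum-rung i g = trans (sum-cong-≗ (λ l → cong (λ b → b2n b * g l) (does-⇔ mi≡ml⇔i≡l (m i ≟ᶠ m l) (i ≟ᶠ l))))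
                         (sum-δ i g)
      where
      mi≡ml⇔i≡l : ∀ {l} → m i ≡ m l ⇔ i ≡ l
      mi≡ml⇔i≡l = mk⇔ (λ mi≡ml → sym (m-injective (sym mi≡ml))) (cong m)

    A-colAtRung : ∀ i (g : Fin n → ℕ) → sum (λ l → b2n (A l (m i)) * g l) ≡ g i + sum (λ c → g (owner (m i , c)))
    A-colAtRung i g = trans (A-colDecomposition (m i) g) (cong (_+ sum (λ c → g (owner (m i , c)))) (sum-rung i g))

    E-colSum : ∀ w → sum× (λ x → b2n (E x w)) ≡ 3
    E-colSum w = begin
      sum× (λ x → b2n (E x w))
        ≡⟨ sum×-cong (λ x → b2n-E x w) ⟩
      sum× (λ x → rung (proj₁ x) + b2n (f x ==ᴾ w))
        ≡⟨ sum×-distrib-+ {k = 2} (λ x → rung (proj₁ x)) (λ x → b2n (f x ==ᴾ w)) ⟩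
      sum (λ i → rung i + (rung i + 0)) + sum× (λ x → b2n (f x ==ᴾ w))
        ≡⟨ cong₂ _+_ rungs-at-w preimage-of-w ⟩
      3 ∎
      where
      rung : Fin n → ℕ
      rung i = b2n (proj₁ w == m i)
      rungs-at-w : sum (λ i → rung i + (rung i + 0)) ≡ 2
      rungs-at-w = begin
        sum (λ i → rung i + (rung i + 0))   ≡⟨ ∑-distrib-+ rung (λ i → rung i + 0) ⟩
        sum rung + sum (λ i → rung i + 0)   ≡⟨ cong (sum rung +_) (sum-cong-≗ (λ i → +-identityʳ (rung i))) ⟩
        sum rung + sum rung                 ≡⟨ cong₂ _+_ (rungCount (proj₁ w)) (rungCount (proj₁ w)) ⟩
        2                                   ∎
      preimage-of-w : sum× (λ x → b2n (f x ==ᴾ w)) ≡ 1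
      preimage-of-w = trans (sum×-cong (λ x → sym (*-identityʳ (b2n (f x ==ᴾ w))))) (sum×-f w (const 1))

    expansion-colSum : ∀ y → ∑ (λ x → b2n (expansion m f x y)) ≡ 3
    expansion-colSum y = begin
      ∑ (λ x → b2n (expansion m f x y))        ≡⟨ ∑≡sum (λ x → b2n (expansion m f x y)) ⟩
      sum (λ x → b2n (expansion m f x y))      ≡⟨ sum-cong-≗ (λ x → cong b2n (expansion≡E x y)) ⟩
      sum (λ x → b2n (E (remQuot 2 x) q))      ≡⟨ sum-remQuot n 2 (λ x → b2n (E x q)) ⟩
      sum× (λ x → b2n (E x q))                 ≡⟨ E-colSum q ⟩
      3                                        ∎
      where
      q : Vertex
      q = remQuot 2 y

    module _ (BᵀA≡J+I : ∀ j M → ∑ (λ l → b2n (B l j) * b2n (A l M)) ≡ 1 + b2n (j == M)) where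

      B-aroundRung : ∀ i j → sum (λ c → b2n (B (owner (m i , c)) j)) + b2n (B i j) ≡ 1 + b2n (j == m i)
      B-aroundRung i j = begin
        sum (λ c → β (owner (m i , c))) + β i   ≡⟨ +-comm (sum (λ c → β (owner (m i , c)))) (β i) ⟩
        β i + sum (λ c → β (owner (m i , c)))   ≡⟨ A-colAtRung i β ⟨
        sum (λ l → b2n (A l (m i)) * β l)        ≡⟨ sum-cong-≗ (λ l → *-comm (b2n (A l (m i))) (β l)) ⟩
        sum (λ l → β l * b2n (A l (m i)))        ≡⟨ ∑≡sum (λ l → β l * b2n (A l (m i))) ⟨
        ∑ (λ l → β l * b2n (A l (m i)))          ≡⟨ BᵀA≡J+I j (m i) ⟩
        1 + b2n (j == m i)                       ∎
        where
        β : Fin n → ℕ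
        β l = b2n (B l j)

      E*Bᴱᵀ+I≡J : ∀ x y → sum× (λ w → b2n (E x w) * b2n (Bᴱ y w)) + b2n (x ==ᴾ y) ≡ 1
      E*Bᴱᵀ+I≡J x y = +-cancelʳ-≡ (b2n (J == M)) (sum× (λ w → b2n (E x w) * bᴱ w) + b2n (x ==ᴾ y)) 1 (begin
        (sum× (λ w → b2n (E x w) * bᴱ w) + b2n (x ==ᴾ y)) + b2n (J == M)
          ≡⟨ cong₂ _+_ (cong₂ _+_ (E-rowSum x bᴱ) x==y≡fy==fx) (sym (sum-==ᴾ (f y) M)) ⟩
        ((sum (λ c → bᴱ (M , c)) + bᴱ (f x)) + fy= (f x)) + sum (λ c → fy= (M , c))
          ≡⟨ solve 4 (λ a b c d → ((a :+ b) :+ c) :+ d := (a :+ d) :+ (b :+ c)) refl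
                     (sum (λ c → bᴱ (M , c))) (bᴱ (f x)) (fy= (f x)) (sum (λ c → fy= (M , c))) ⟩
        (sum (λ c → bᴱ (M , c)) + sum (λ c → fy= (M , c))) + (bᴱ (f x) + fy= (f x))
          ≡⟨ cong (_+ (bᴱ (f x) + fy= (f x))) (∑-distrib-+ (λ c → bᴱ (M , c)) (λ c → fy= (M , c))) ⟨
        sum (λ c → bᴱ (M , c) + fy= (M , c)) + (bᴱ (f x) + fy= (f x))
          ≡⟨ cong₂ _+_ (sum-cong-≗ (λ c → Bᴱ-split y (M , c))) (Bᴱ-split y (f x)) ⟩
        sum (λ c → β (owner (M , c))) + β (owner (f x))
          ≡⟨ cong (λ v → sum (λ c → β (owner (M , c))) + β (proj₁ v)) (f⁻¹∘f x) ⟩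
        sum (λ c → β (owner (M , c))) + β (proj₁ x)
          ≡⟨ B-aroundRung (proj₁ x) J ⟩
        1 + b2n (J == M) ∎)
        where
        open +-*-Solver
        M J : Fin n
        M = m (proj₁ x)
        J = target y
        bᴱ fy= : Vertex → ℕ
        bᴱ w = b2n (Bᴱ y w)
        fy= w = b2n (f y ==ᴾ w)
        β : Fin n → ℕ
        β l = b2n (B l J)
        x==y≡fy==fx : b2n (x ==ᴾ y) ≡ fy= (f x)
        x==y≡fy==fx = cong b2n (does-⇔ (mk⇔ (λ x≡y → cong f (sym x≡y)) (λ fy≡fx → sym (f-injective fy≡fx)))
                                       (x ≟ᴾ y) (f y ≟ᴾ f x))

      expansion-lehman : ∀ x y → ∑ (λ w → b2n (expansion m f x w) * b2n (flatten Bᴱ y w)) + b2n (x == y) ≡ 1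
      expansion-lehman x y = begin
        ∑ (λ w → b2n (expansion m f x w) * b2n (flatten Bᴱ y w)) + b2n (x == y)
          ≡⟨ cong₂ _+_ (∑≡sum (λ w → b2n (expansion m f x w) * b2n (flatten Bᴱ y w)))
                       (cong b2n (==-remQuot n 2 x y)) ⟩
        sum (λ w → b2n (expansion m f x w) * b2n (flatten Bᴱ y w)) + b2n (p ==ᴾ q)
          ≡⟨ cong (_+ b2n (p ==ᴾ q))
                  (sum-cong-≗ (λ w → cong (λ b → b2n b * b2n (flatten Bᴱ y w)) (expansion≡E x w))) ⟩
        sum (λ w → b2n (E p (remQuot 2 w)) * b2n (Bᴱ q (remQuot 2 w))) + b2n (p ==ᴾ q)
          ≡⟨ cong (_+ b2n (p ==ᴾ q)) (sum-remQuot n 2 (λ w → b2n (E p w) * b2n (Bᴱ q w))) ⟩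
        sum× (λ w → b2n (E p w) * b2n (Bᴱ q w)) + b2n (p ==ᴾ q)
          ≡⟨ E*Bᴱᵀ+I≡J p q ⟩
        1 ∎
        where
        p q : Vertex
        p = remQuot 2 x
        q = remQuot 2 y

module CubicLehman where
  open import Data.Nat as ℕ using ()
  open import Data.Nat.Properties using (m+1+n≢0)
  open import Data.Integer using (ℤ; +_; _+_; _*_)
  open import Data.Integer.Properties using (+-*-semiring; pos-+; pos-*; +-injective; *-identityˡ)
  open import Algebra.Properties.Semiring.Sum +-*-semiring using (sum; sum-cong-≗)
  open IntegerMatrix
  open ≡-Reasoning

  +∑ : ∀ {n} (g : Fin n → ℕ) → + ∑ g ≡ sum (λ i → + g i)
  +∑ {ℕ.zero}  g = refl
  +∑ {ℕ.suc n} g = trans (pos-+ (g zero) (∑ (g ∘ suc))) (cong (λ s → + g zero + s) (+∑ (g ∘ suc)))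

  integerMatrix : ∀ {n} → BiMat n → Matrix n n
  integerMatrix M i j = + b2n (M i j)

  if-b2n : ∀ b → (if b then + 1 else + 0) ≡ + b2n b
  if-b2n true  = refl
  if-b2n false = refl

  cubicLehman-transpose : ∀ {n} (A B : BiMat n) → Cubic A → LehmanWitness A (+ 1) B →
                          ∀ j M → ∑ (λ l → b2n (B l j) ℕ.* b2n (A l M)) ≡ 1 ℕ.+ b2n (j == M)
  cubicLehman-transpose {n} A B (rowSum , colSum) lehman j M = +-injective (begin
    + ∑ (λ l → b2n (B l j) ℕ.* b2n (A l M))        ≡⟨ +∑ (λ l → b2n (B l j) ℕ.* b2n (A l M)) ⟩
    sum (λ l → + (b2n (B l j) ℕ.* b2n (A l M)))    ≡⟨ sum-cong-≗ (λ l → pos-* (b2n (B l j)) (b2n (A l M))) ⟩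
    (Bℤ ᵀ *ₘ Aℤ) j M
      ≡⟨ lehman-transpose Aℤ Bℤ (+ 1) (+ 3) (λ ()) (m+1+n≢0 n ∘ +-injective) rows cols lehmanℤ j M ⟩
    + 1 + + 1 * δ j M
      ≡⟨ cong (λ d → + 1 + d) (trans (*-identityˡ (δ j M)) (if-b2n (j == M))) ⟩
    + (1 ℕ.+ b2n (j == M))                        ∎)
    where
    Aℤ Bℤ : Matrix n n
    Aℤ = integerMatrix A
    Bℤ = integerMatrix B
    rows : ∀ i → sum (Aℤ i) ≡ + 3
    rows i = trans (sym (+∑ (λ l → b2n (A i l)))) (cong +_ (rowSum i))
    cols : ∀ l → sum ((Aℤ ᵀ) l) ≡ + 3
    cols l = trans (sym (+∑ (λ i → b2n (A i l)))) (cong +_ (colSum l))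
    lehmanℤ : ∀ i k → (Aℤ *ₘ Bℤ ᵀ) i k ≡ J+kI (+ 1) i k
    lehmanℤ i k = begin
      sum (λ l → + b2n (A i l) * + b2n (B k l))     ≡⟨ sum-cong-≗ (λ l → pos-* (b2n (A i l)) (b2n (B k l))) ⟨
      sum (λ l → + (b2n (A i l) ℕ.* b2n (B k l)))   ≡⟨ +∑ (λ l → b2n (A i l) ℕ.* b2n (B k l)) ⟨
      + ∑ (λ l → b2n (A i l) ℕ.* b2n (B k l))       ≡⟨ lehman i k ⟩
      + 1 + δ i k                                   ≡⟨ cong (λ d → + 1 + d) (*-identityˡ (δ i k)) ⟨
      + 1 + + 1 * δ i k                             ∎

open import Data.Nat using (_+_; _*_)
open import Data.Nat.Properties using (+-cancelʳ-≡; +-identityʳ)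
open import Data.Integer as ℤ using (+_; -[1+_])
open CubicLehman using (cubicLehman-transpose)

negativeLehmanEntry : ∀ {L} b → L + b2n b ≡ 1 → + L ≡ + 1 ℤ.+ (if b then -[1+ 0 ] else + 0)
negativeLehmanEntry true  L+1≡1 = cong +_ (+-cancelʳ-≡ 1 _ 0 L+1≡1)
negativeLehmanEntry false L+0≡1 = cong +_ (trans (sym (+-identityʳ _)) L+0≡1)

lemma4p7 : (n : ℕ) (A B : BiMat n) (m : Fin n → Fin n) (f : Fin n × Fin 2 → Fin n × Fin 2) →
    Cubic A → LehmanWitness A (+ 1) B → IsRungMatching A B m → ValidChoice A m f →
    CubicNegativeLehman (expansion m f)
lemma4p7 n A B m f (rowSum , colSum) lehman rungs valid =
  (expansion-rowSum , expansion-colSum colSum) , flatten Bᴱ , lehmanᴱ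
  where
  open BicliqueExpansion A B m f rungs valid
  BᵀA≡J+I : ∀ j M → ∑ (λ l → b2n (B l j) * b2n (A l M)) ≡ 1 + b2n (j == M)
  BᵀA≡J+I = cubicLehman-transpose A B (rowSum , colSum) lehman
  lehmanᴱ : LehmanWitness (expansion m f) -[1+ 0 ] (flatten Bᴱ)
  lehmanᴱ x y = negativeLehmanEntry (x == y) (expansion-lehman colSum BᵀA≡J+I x y)
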